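{- For every positive integer $n$, \[ \sum_{k=0}^{\lfloor \lg n \rfloor} \sum_{i=0}^{2^k-1} \left\lfloor \frac{n+i}{2^{k+1}} \right\rfloor \;=\; \frac{n}{2}\left(\lfloor \lg n \rfloor + 1\right) - \sum_{k=0}^{\lfloor \lg n \rfloor} 2^k \, \mathrm{Zigzag}\!\left(\frac{n}{2^{k+1}}\right). \]
   Context: $\lg$ denotes the logarithm to base 2. For a real number $x$, $\mathrm{Zigzag}(x) = \min\left(x - \lfloor x \rfloor,\ \lceil x \rceil - x\right)$. -}

module Defs where

open import Data.Nat using (ℕ; zero; suc; _^_)
open import Data.Nat.Properties using (m^n≢0)
open import Data.Integer using (+_)
open import Data.Rational using (ℚ; 0ℚ; _+_; _-_; _⊓_; floor; ceiling; _/_)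
open import Data.Integer using (ℤ)

sumTo : ℕ → (ℕ → ℚ) → ℚ
sumTo zero    f = f 0
sumTo (suc m) f = sumTo m f + f (suc m)

sumBelow : ℕ → (ℕ → ℚ) → ℚ
sumBelow zero    f = 0ℚ
sumBelow (suc m) f = sumBelow m f + f m

fromℤ : ℤ → ℚ
fromℤ z = z / 1

fromℕ : ℕ → ℚ
fromℕ a = + a / 1

_/2^_ : ℕ → ℕ → ℚ
a /2^ j = _/_ (+ a) (2 ^ j) {{m^n≢0 2 j}}

Zigzag : ℚ → ℚ
Zigzag x = (x - fromℤ (floor x)) ⊓ (fromℤ (ceiling x) - x)

-- Fix a level k and write N = 2^(k+1) = 2m and n = qN + r with 0 ≤ r < N. For i < m the term
-- ⌊(n+i)/N⌋ is q + 1 when r + i ≥ N and q otherwise, so the inner sum is mq + (r ∸ m).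
-- On the other side N·Zigzag(n/N) = min(r, N − r), hence n/2 − m·Zigzag(n/N) = mq + (r − min(r, N − r))/2,
-- which is again mq + (r ∸ m). The theorem is the sum of these identities over the levels 0 … ⌊lg n⌋.
module Submission where

open import Data.Empty using (⊥-elim)
open import Data.Integer as ℤ using (+_; -[1+_])
import Data.Integer.Properties as ℤ
open import Data.Integer.Tactic.RingSolver using (solve-∀)
open import Data.Nat using (ℕ; zero; suc; NonZero; _≤_; _<_; _∸_; _^_)
import Data.Nat as ℕ
import Data.Nat.Properties as ℕ
open import Algebra.Properties.CommutativeSemigroup ℕ.+-commutativeSemigroup using (xy∙z≈xz∙y)
open import Data.Nat.Coprimality using (Coprime)
open import Data.Nat.Divisibility using (n∣m*n)
open import Data.Nat.DivMod
  using (_%_; m≡m%n+[m/n]*n; m%n<n; m*n/n≡m; m/n*n≡m; m<n⇒m/n≡0; m/n≡1+[m∸n]/n; +-distrib-/-∣ʳ;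
         m*n/o*n≡m/o; m%n*o≡m*o%[n*o]; /-congˡ; /-congʳ; %-congˡ; %-congʳ)
open import Data.Nat.GCD using (gcd; gcd[m,n]∣m; gcd[m,n]∣n; gcd[m,n]≢0; n/gcd[m,n]≢0)
open import Data.Nat.Logarithm using (⌊log₂_⌋)
import Data.Nat.Tactic.RingSolver as ℕ-Solver
open import Data.Rational as ℚ using (ℚ; mkℚ+; floor; ceiling; _+_; _-_; _*_; _⊓_; _/_)
import Data.Rational.Properties as ℚ
open import Data.Rational.Solver using (module +-*-Solver)
open import Data.Rational.Unnormalised as ℚᵘ using (mkℚᵘ; *≡*; *≤*)
import Data.Rational.Unnormalised.Properties as ℚᵘ
open import Data.Sum using (inj₁; inj₂)
open import Relation.Binary.PropositionalEquality
open import Relation.Nullary using (Dec; yes; no)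

open import Defs

open +-*-Solver using (solve; _:+_; _:*_; _:-_; :-_; con; _:=_)

toℚᵘ-fromℤ : ∀ i → ℚ.toℚᵘ (fromℤ i) ℚᵘ.≃ mkℚᵘ i 0
toℚᵘ-fromℤ i = ℚ.toℚᵘ-fromℚᵘ (mkℚᵘ i 0)

fromℤ-+ : ∀ i j → fromℤ (i ℤ.+ j) ≡ fromℤ i + fromℤ j
fromℤ-+ i j = ℚ.toℚᵘ-injective (begin
  ℚ.toℚᵘ (fromℤ (i ℤ.+ j))                ≈⟨ toℚᵘ-fromℤ (i ℤ.+ j) ⟩
  mkℚᵘ (i ℤ.+ j) 0                        ≈⟨ *≡* (normalise i j) ⟩
  mkℚᵘ i 0 ℚᵘ.+ mkℚᵘ j 0                  ≈⟨ ℚᵘ.+-cong (toℚᵘ-fromℤ i) (toℚᵘ-fromℤ j) ⟨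
  ℚ.toℚᵘ (fromℤ i) ℚᵘ.+ ℚ.toℚᵘ (fromℤ j)  ≈⟨ ℚ.toℚᵘ-homo-+ (fromℤ i) (fromℤ j) ⟨
  ℚ.toℚᵘ (fromℤ i + fromℤ j)              ∎)
  where
  open ℚᵘ.≃-Reasoning
  normalise : ∀ i j → (i ℤ.+ j) ℤ.* (ℤ.1ℤ ℤ.* ℤ.1ℤ) ≡ (i ℤ.* ℤ.1ℤ ℤ.+ j ℤ.* ℤ.1ℤ) ℤ.* ℤ.1ℤ
  normalise = solve-∀

fromℤ-* : ∀ i j → fromℤ (i ℤ.* j) ≡ fromℤ i * fromℤ j
fromℤ-* i j = ℚ.toℚᵘ-injective (begin
  ℚ.toℚᵘ (fromℤ (i ℤ.* j))                ≈⟨ toℚᵘ-fromℤ (i ℤ.* j) ⟩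
  mkℚᵘ (i ℤ.* j) 0                        ≈⟨ *≡* (normalise i j) ⟩
  mkℚᵘ i 0 ℚᵘ.* mkℚᵘ j 0                  ≈⟨ ℚᵘ.*-cong (toℚᵘ-fromℤ i) (toℚᵘ-fromℤ j) ⟨
  ℚ.toℚᵘ (fromℤ i) ℚᵘ.* ℚ.toℚᵘ (fromℤ j)  ≈⟨ ℚ.toℚᵘ-homo-* (fromℤ i) (fromℤ j) ⟨
  ℚ.toℚᵘ (fromℤ i * fromℤ j)              ∎)
  where
  open ℚᵘ.≃-Reasoning
  normalise : ∀ i j → (i ℤ.* j) ℤ.* (ℤ.1ℤ ℤ.* ℤ.1ℤ) ≡ (i ℤ.* j) ℤ.* ℤ.1ℤ
  normalise = solve-∀

fromℕ-*-/ : ∀ d .{{_ : NonZero d}} i → fromℕ d * (i / d) ≡ fromℤ i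
fromℕ-*-/ (suc d) i = ℚ.toℚᵘ-injective (begin
  ℚ.toℚᵘ (fromℕ (suc d) * (i / suc d))            ≈⟨ ℚ.toℚᵘ-homo-* (fromℕ (suc d)) (i / suc d) ⟩
  ℚ.toℚᵘ (fromℕ (suc d)) ℚᵘ.* ℚ.toℚᵘ (i / suc d)  ≈⟨ ℚᵘ.*-cong (toℚᵘ-fromℤ (+ suc d)) (ℚ.toℚᵘ-fromℚᵘ (mkℚᵘ i d)) ⟩
  mkℚᵘ (+ suc d) 0 ℚᵘ.* mkℚᵘ i d                  ≈⟨ *≡* (normalise (+ suc d) i) ⟩
  mkℚᵘ i 0                                        ≈⟨ toℚᵘ-fromℤ i ⟨
  ℚ.toℚᵘ (fromℤ i)                                ∎)
  where
  open ℚᵘ.≃-Reasoning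
  normalise : ∀ d i → (d ℤ.* i) ℤ.* ℤ.1ℤ ≡ i ℤ.* (ℤ.1ℤ ℤ.* d)
  normalise = solve-∀

fromℕ-+ : ∀ a b → fromℕ (a ℕ.+ b) ≡ fromℕ a + fromℕ b
fromℕ-+ a b = trans (cong fromℤ (ℤ.pos-+ a b)) (fromℤ-+ (+ a) (+ b))

fromℕ-* : ∀ a b → fromℕ (a ℕ.* b) ≡ fromℕ a * fromℕ b
fromℕ-* a b = trans (cong fromℤ (ℤ.pos-* a b)) (fromℤ-* (+ a) (+ b))

fromℕ-∸ : ∀ {a b} → b ≤ a → fromℕ (a ∸ b) ≡ fromℕ a - fromℕ b
fromℕ-∸ {a} {b} b≤a = begin
  fromℕ (a ∸ b)                        ≡⟨ solve 2 (λ c b → c := (b :+ c) :- b) refl (fromℕ (a ∸ b)) (fromℕ b) ⟩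
  (fromℕ b + fromℕ (a ∸ b)) - fromℕ b  ≡⟨ cong (_- fromℕ b) (fromℕ-+ b (a ∸ b)) ⟨
  fromℕ (b ℕ.+ (a ∸ b)) - fromℕ b      ≡⟨ cong (λ c → fromℕ c - fromℕ b) (ℕ.m+[n∸m]≡n b≤a) ⟩
  fromℕ a - fromℕ b                    ∎
  where open ≡-Reasoning

fromℕ-mono-≤ : ∀ {a b} → a ≤ b → fromℕ a ℚ.≤ fromℕ b
fromℕ-mono-≤ {a} {b} a≤b = ℚ.toℚᵘ-cancel-≤ (begin
  ℚ.toℚᵘ (fromℕ a)  ≃⟨ toℚᵘ-fromℤ (+ a) ⟩
  mkℚᵘ (+ a) 0      ≤⟨ *≤* (ℤ.*-monoʳ-≤-nonNeg ℤ.1ℤ (ℤ.+≤+ a≤b)) ⟩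
  mkℚᵘ (+ b) 0      ≃⟨ toℚᵘ-fromℤ (+ b) ⟨
  ℚ.toℚᵘ (fromℕ b)  ∎)
  where open ℚᵘ.≤-Reasoning

fromℕ-⊓ : ∀ a b → fromℕ (a ℕ.⊓ b) ≡ fromℕ a ⊓ fromℕ b
fromℕ-⊓ a b with ℕ.≤-total a b
... | inj₁ a≤b = trans (cong fromℕ (ℕ.m≤n⇒m⊓n≡m a≤b)) (sym (ℚ.p≤q⇒p⊓q≡p (fromℕ-mono-≤ a≤b)))
... | inj₂ b≤a = trans (cong fromℕ (ℕ.m≥n⇒m⊓n≡n b≤a)) (sym (ℚ.p≥q⇒p⊓q≡q (fromℕ-mono-≤ b≤a)))

*-sub-quotient : ∀ D X Q R → D * X ≡ R + Q * D → D * (X - Q) ≡ R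
*-sub-quotient D X Q R D*X≡R+Q*D = begin
  D * (X - Q)        ≡⟨ solve 3 (λ D X Q → D :* (X :- Q) := D :* X :- Q :* D) refl D X Q ⟩
  D * X - Q * D      ≡⟨ cong (_- Q * D) D*X≡R+Q*D ⟩
  R + Q * D - Q * D  ≡⟨ solve 2 (λ R P → R :+ P :- P := R) refl R (Q * D) ⟩
  R                  ∎
  where open ≡-Reasoning

*-quotient-sub : ∀ D X Q R → D * X ≡ R + Q * D → D * (Q - X) ≡ ℚ.- R
*-quotient-sub D X Q R D*X≡R+Q*D = begin
  D * (Q - X)          ≡⟨ solve 3 (λ D X Q → D :* (Q :- X) := Q :* D :- D :* X) refl D X Q ⟩
  Q * D - D * X        ≡⟨ cong (Q * D -_) D*X≡R+Q*D ⟩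
  Q * D - (R + Q * D)  ≡⟨ solve 2 (λ R P → P :- (R :+ P) := :- R) refl R (Q * D) ⟩
  ℚ.- R                ∎
  where open ≡-Reasoning

*-suc-quotient-sub : ∀ D X Q R → D * X ≡ R + Q * D → D * ((ℚ.1ℚ + Q) - X) ≡ D - R
*-suc-quotient-sub D X Q R D*X≡R+Q*D = begin
  D * ((ℚ.1ℚ + Q) - X)
    ≡⟨ solve 3 (λ D X Q → D :* ((con ℚ.1ℚ :+ Q) :- X) := D :+ Q :* D :- D :* X) refl D X Q ⟩
  D + Q * D - D * X        ≡⟨ cong (D + Q * D -_) D*X≡R+Q*D ⟩
  D + Q * D - (R + Q * D)  ≡⟨ solve 3 (λ D R P → D :+ P :- (R :+ P) := D :- R) refl D R (Q * D) ⟩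
  D - R                    ∎
  where open ≡-Reasoning

halve : ∀ c h M Z z n → fromℕ 2 * c + z ≡ n → fromℕ 2 * h ≡ n → (fromℕ 2 * M) * Z ≡ z → c ≡ h - M * Z
halve c h M Z z n 2c+z≡n 2h≡n 2MZ≡z = begin
  c
    ≡⟨ solve 2 (λ c z → c := con ℚ.½ :* (con (fromℕ 2) :* c :+ z) :- con ℚ.½ :* z) refl c z ⟩
  ℚ.½ * (fromℕ 2 * c + z) - ℚ.½ * z
    ≡⟨ cong (λ w → ℚ.½ * w - ℚ.½ * z) 2c+z≡n ⟩
  ℚ.½ * n - ℚ.½ * z
    ≡⟨ cong₂ (λ u v → ℚ.½ * u - ℚ.½ * v) 2h≡n 2MZ≡z ⟨
  ℚ.½ * (fromℕ 2 * h) - ℚ.½ * ((fromℕ 2 * M) * Z)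
    ≡⟨ solve 3 (λ h M Z → con ℚ.½ :* (con (fromℕ 2) :* h) :- con ℚ.½ :* ((con (fromℕ 2) :* M) :* Z)
                          := h :- M :* Z) refl h M Z ⟩
  h - M * Z
    ∎
  where open ≡-Reasoning

floor-mkℚ+ : ∀ A D .{{_ : NonZero D}} .(c : Coprime A D) → floor (mkℚ+ A D c) ≡ + (A ℕ./ D)
floor-mkℚ+ A (suc D) c = ℤ.*-identityˡ (+ (A ℕ./ suc D))

ceiling-mkℚ+-exact : ∀ A D .{{_ : NonZero D}} .(c : Coprime A D) → A % D ≡ 0 →
                     ceiling (mkℚ+ A D c) ≡ + (A ℕ./ D)
ceiling-mkℚ+-exact zero    (suc D) c A%D≡0 = refl
ceiling-mkℚ+-exact (suc A) (suc D) c A%D≡0 rewrite A%D≡0 =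
  trans (cong ℤ.-_ (ℤ.*-identityˡ _)) (ℤ.neg-involutive _)

ceiling-mkℚ+-inexact : ∀ A D .{{_ : NonZero D}} .(c : Coprime A D) → A % D ≢ 0 →
                       ceiling (mkℚ+ A D c) ≡ + suc (A ℕ./ D)
ceiling-mkℚ+-inexact zero    (suc D) c A%D≢0 = ⊥-elim (A%D≢0 refl)
ceiling-mkℚ+-inexact (suc A) (suc D) c A%D≢0 with suc A % suc D
... | zero  = ⊥-elim (A%D≢0 refl)
... | suc _ = cong ℤ.-_ (ℤ.*-identityˡ -[1+ (suc A ℕ./ suc D) ])

module _ (a d : ℕ) .{{_ : NonZero d}} where
  private
    g = gcd a d
    instance
      g≢0 : NonZero g
      g≢0 = ℕ.≢-nonZero (gcd[m,n]≢0 a d (inj₂ (ℕ.≢-nonZero⁻¹ d)))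
      d/g≢0 : NonZero (d ℕ./ g)
      d/g≢0 = ℕ.≢-nonZero (n/gcd[m,n]≢0 a d)
      [d/g]*g≢0 : NonZero (d ℕ./ g ℕ.* g)
      [d/g]*g≢0 = ℕ.m*n≢0 (d ℕ./ g) g
    -- + a / d is stored in lowest terms, as A / D
    A = a ℕ./ g
    D = d ℕ./ g

    A/D≡a/d : A ℕ./ D ≡ a ℕ./ d
    A/D≡a/d = begin
      A ℕ./ D                ≡⟨ m*n/o*n≡m/o A g D ⟨
      A ℕ.* g ℕ./ (D ℕ.* g)  ≡⟨ /-congˡ {o = D ℕ.* g} (m/n*n≡m (gcd[m,n]∣m a d)) ⟩
      a ℕ./ (D ℕ.* g)        ≡⟨ /-congʳ (m/n*n≡m (gcd[m,n]∣n a d)) ⟩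
      a ℕ./ d                ∎
      where open ≡-Reasoning

    [A%D]*g≡a%d : A % D ℕ.* g ≡ a % d
    [A%D]*g≡a%d = begin
      A % D ℕ.* g          ≡⟨ m%n*o≡m*o%[n*o] A D g ⟩
      A ℕ.* g % (D ℕ.* g)  ≡⟨ %-congˡ {o = D ℕ.* g} (m/n*n≡m (gcd[m,n]∣m a d)) ⟩
      a % (D ℕ.* g)        ≡⟨ %-congʳ (m/n*n≡m (gcd[m,n]∣n a d)) ⟩
      a % d                ∎
      where open ≡-Reasoning

  floor-/ : floor (+ a / d) ≡ + (a ℕ./ d)
  floor-/ = trans (floor-mkℚ+ A D _) (cong +_ A/D≡a/d)

  ceiling-/-exact : a % d ≡ 0 → ceiling (+ a / d) ≡ + (a ℕ./ d)
  ceiling-/-exact a%d≡0 =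
    trans (ceiling-mkℚ+-exact A D _ (ℕ.m*n≡0⇒m≡0 (A % D) g (trans [A%D]*g≡a%d a%d≡0)))
          (cong +_ A/D≡a/d)

  ceiling-/-inexact : a % d ≢ 0 → ceiling (+ a / d) ≡ + suc (a ℕ./ d)
  ceiling-/-inexact a%d≢0 =
    trans (ceiling-mkℚ+-inexact A D _ (λ A%D≡0 → a%d≢0 (trans (sym [A%D]*g≡a%d) (cong (ℕ._* g) A%D≡0))))
          (cong (λ q → + suc q) A/D≡a/d)

module _ (a d : ℕ) .{{_ : NonZero d}} where
  private
    x = + a / d
    q = a ℕ./ d
    r = a % d

    d*x≡r+q*d : fromℕ d * x ≡ fromℕ r + fromℕ q * fromℕ d
    d*x≡r+q*d = begin
      fromℕ d * x                  ≡⟨ fromℕ-*-/ d (+ a) ⟩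
      fromℕ a                      ≡⟨ cong fromℕ (m≡m%n+[m/n]*n a d) ⟩
      fromℕ (r ℕ.+ q ℕ.* d)        ≡⟨ fromℕ-+ r (q ℕ.* d) ⟩
      fromℕ r + fromℕ (q ℕ.* d)    ≡⟨ cong (λ p → fromℕ r + p) (fromℕ-* q d) ⟩
      fromℕ r + fromℕ q * fromℕ d  ∎
      where open ≡-Reasoning

    floor-gap : fromℕ d * (x - fromℤ (floor x)) ≡ fromℕ r
    floor-gap = trans (cong (λ z → fromℕ d * (x - fromℤ z)) (floor-/ a d))
                      (*-sub-quotient (fromℕ d) x (fromℕ q) (fromℕ r) d*x≡r+q*d)

    ceiling-gap-exact : r ≡ 0 → fromℕ d * (fromℤ (ceiling x) - x) ≡ ℚ.- fromℕ r
    ceiling-gap-exact r≡0 = trans (cong (λ z → fromℕ d * (fromℤ z - x)) (ceiling-/-exact a d r≡0))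
                                  (*-quotient-sub (fromℕ d) x (fromℕ q) (fromℕ r) d*x≡r+q*d)

    ceiling-gap-inexact : r ≢ 0 → fromℕ d * (fromℤ (ceiling x) - x) ≡ fromℕ (d ∸ r)
    ceiling-gap-inexact r≢0 = begin
      fromℕ d * (fromℤ (ceiling x) - x)  ≡⟨ cong (λ z → fromℕ d * (fromℤ z - x)) (ceiling-/-inexact a d r≢0) ⟩
      fromℕ d * (fromℕ (1 ℕ.+ q) - x)    ≡⟨ cong (λ z → fromℕ d * (z - x)) (fromℕ-+ 1 q) ⟩
      fromℕ d * ((ℚ.1ℚ + fromℕ q) - x)   ≡⟨ *-suc-quotient-sub (fromℕ d) x (fromℕ q) (fromℕ r) d*x≡r+q*d ⟩
      fromℕ d - fromℕ r                  ≡⟨ fromℕ-∸ (ℕ.<⇒≤ (m%n<n a d)) ⟨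
      fromℕ (d ∸ r)                      ∎
      where open ≡-Reasoning

    instance
      fromℕ-d-nonNeg : ℚ.NonNegative (fromℕ d)
      fromℕ-d-nonNeg = ℚ.normalize-nonNeg d 1

  *-Zigzag-/ : fromℕ d * Zigzag (+ a / d) ≡ fromℕ (a % d ℕ.⊓ (d ∸ a % d))
  *-Zigzag-/ = trans (ℚ.*-distribˡ-⊓-nonNeg (fromℕ d) _ _) (gaps (a % d ℕ.≟ 0))
    where
    gaps : Dec (r ≡ 0) → (fromℕ d * (x - fromℤ (floor x))) ⊓ (fromℕ d * (fromℤ (ceiling x) - x))
                         ≡ fromℕ (r ℕ.⊓ (d ∸ r))
    gaps (yes r≡0) = begin
      (fromℕ d * (x - fromℤ (floor x))) ⊓ (fromℕ d * (fromℤ (ceiling x) - x))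
                              ≡⟨ cong₂ _⊓_ floor-gap (ceiling-gap-exact r≡0) ⟩
      fromℕ r ⊓ ℚ.- fromℕ r   ≡⟨ cong (λ r → fromℕ r ⊓ ℚ.- fromℕ r) r≡0 ⟩
      fromℕ (0 ℕ.⊓ (d ∸ 0))   ≡⟨ cong (λ r → fromℕ (r ℕ.⊓ (d ∸ r))) r≡0 ⟨
      fromℕ (r ℕ.⊓ (d ∸ r))   ∎
      where open ≡-Reasoning
    gaps (no r≢0) = trans (cong₂ _⊓_ floor-gap (ceiling-gap-inexact r≢0)) (sym (fromℕ-⊓ r (d ∸ r)))

module _ (N : ℕ) .{{_ : NonZero N}} where

  [m∸n]+m/n≡[1+m]∸n : ∀ a → a < N ℕ.+ N → a ∸ N ℕ.+ a ℕ./ N ≡ suc a ∸ N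
  [m∸n]+m/n≡[1+m]∸n a a<2N with a ℕ.<? N
  ... | yes a<N = begin
    a ∸ N ℕ.+ a ℕ./ N  ≡⟨ cong₂ ℕ._+_ (ℕ.m≤n⇒m∸n≡0 (ℕ.<⇒≤ a<N)) (m<n⇒m/n≡0 a<N) ⟩
    0                  ≡⟨ ℕ.m≤n⇒m∸n≡0 a<N ⟨
    suc a ∸ N          ∎
    where open ≡-Reasoning
  ... | no a≮N = begin
    a ∸ N ℕ.+ a ℕ./ N              ≡⟨ cong (a ∸ N ℕ.+_) (m/n≡1+[m∸n]/n N≤a) ⟩
    a ∸ N ℕ.+ suc ((a ∸ N) ℕ./ N)  ≡⟨ cong (λ c → a ∸ N ℕ.+ suc c) (m<n⇒m/n≡0 a∸N<N) ⟩
    a ∸ N ℕ.+ 1                    ≡⟨ ℕ.+-comm (a ∸ N) 1 ⟩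
    suc (a ∸ N)                    ≡⟨ ℕ.+-∸-assoc 1 N≤a ⟨
    suc a ∸ N                      ∎
    where
    open ≡-Reasoning
    N≤a : N ≤ a
    N≤a = ℕ.≮⇒≥ a≮N
    a∸N<N : a ∸ N < N
    a∸N<N = subst (_≤ N) (ℕ.+-∸-assoc 1 N≤a) (ℕ.m≤n+o⇒m∸n≤o (suc a) N a<2N)

  /-+-shift : ∀ n t → (n ℕ.+ t) ℕ./ N ≡ n ℕ./ N ℕ.+ (n % N ℕ.+ t) ℕ./ N
  /-+-shift n t = begin
    (n ℕ.+ t) ℕ./ N                              ≡⟨ /-congˡ n+t≡[r+t]+q*N ⟩
    (n % N ℕ.+ t ℕ.+ n ℕ./ N ℕ.* N) ℕ./ N        ≡⟨ +-distrib-/-∣ʳ (n % N ℕ.+ t) (n∣m*n (n ℕ./ N)) ⟩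
    (n % N ℕ.+ t) ℕ./ N ℕ.+ n ℕ./ N ℕ.* N ℕ./ N  ≡⟨ cong ((n % N ℕ.+ t) ℕ./ N ℕ.+_) (m*n/n≡m (n ℕ./ N) N) ⟩
    (n % N ℕ.+ t) ℕ./ N ℕ.+ n ℕ./ N              ≡⟨ ℕ.+-comm _ (n ℕ./ N) ⟩
    n ℕ./ N ℕ.+ (n % N ℕ.+ t) ℕ./ N              ∎
    where
    open ≡-Reasoning
    n+t≡[r+t]+q*N : n ℕ.+ t ≡ n % N ℕ.+ t ℕ.+ n ℕ./ N ℕ.* N
    n+t≡[r+t]+q*N = trans (cong (ℕ._+ t) (m≡m%n+[m/n]*n n N)) (xy∙z≈xz∙y (n % N) (n ℕ./ N ℕ.* N) t)

  -- n % N + t ∸ N counts the i < t with n % N + i ≥ N, i.e. the terms equal to n / N + 1.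
  sum-floor-step : ∀ n t → t < N →
    t ℕ.* (n ℕ./ N) ℕ.+ (n % N ℕ.+ t ∸ N) ℕ.+ (n ℕ.+ t) ℕ./ N ≡ suc t ℕ.* (n ℕ./ N) ℕ.+ (n % N ℕ.+ suc t ∸ N)
  sum-floor-step n t t<N = begin
    t ℕ.* q ℕ.+ (r ℕ.+ t ∸ N) ℕ.+ (n ℕ.+ t) ℕ./ N          ≡⟨ cong (t ℕ.* q ℕ.+ (r ℕ.+ t ∸ N) ℕ.+_) (/-+-shift n t) ⟩
    t ℕ.* q ℕ.+ (r ℕ.+ t ∸ N) ℕ.+ (q ℕ.+ (r ℕ.+ t) ℕ./ N)  ≡⟨ regroup (t ℕ.* q) q (r ℕ.+ t ∸ N) ((r ℕ.+ t) ℕ./ N) ⟩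
    q ℕ.+ t ℕ.* q ℕ.+ (r ℕ.+ t ∸ N ℕ.+ (r ℕ.+ t) ℕ./ N)
      ≡⟨ cong (q ℕ.+ t ℕ.* q ℕ.+_) ([m∸n]+m/n≡[1+m]∸n (r ℕ.+ t) (ℕ.+-mono-< (m%n<n n N) t<N)) ⟩
    suc t ℕ.* q ℕ.+ (suc (r ℕ.+ t) ∸ N)                    ≡⟨ cong (λ c → suc t ℕ.* q ℕ.+ (c ∸ N)) (ℕ.+-suc r t) ⟨
    suc t ℕ.* q ℕ.+ (r ℕ.+ suc t ∸ N)                      ∎
    where
    open ≡-Reasoning
    q = n ℕ./ N
    r = n % N
    regroup : ∀ a b c d → a ℕ.+ c ℕ.+ (b ℕ.+ d) ≡ b ℕ.+ a ℕ.+ (c ℕ.+ d)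
    regroup = ℕ-Solver.solve-∀

  sum-floor : ∀ n t → t ≤ N →
    sumBelow t (λ i → fromℕ ((n ℕ.+ i) ℕ./ N)) ≡ fromℕ (t ℕ.* (n ℕ./ N) ℕ.+ (n % N ℕ.+ t ∸ N))
  sum-floor n zero    _   = sym (cong fromℕ (ℕ.m≤n⇒m∸n≡0 r+0≤N))
    where
    r+0≤N : n % N ℕ.+ 0 ≤ N
    r+0≤N = ℕ.≤-trans (ℕ.≤-reflexive (ℕ.+-identityʳ (n % N))) (ℕ.<⇒≤ (m%n<n n N))
  sum-floor n (suc t) t<N = begin
    sumBelow t (λ i → fromℕ ((n ℕ.+ i) ℕ./ N)) + fromℕ ((n ℕ.+ t) ℕ./ N)
      ≡⟨ cong (_+ fromℕ ((n ℕ.+ t) ℕ./ N)) (sum-floor n t (ℕ.<⇒≤ t<N)) ⟩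
    fromℕ (t ℕ.* (n ℕ./ N) ℕ.+ (n % N ℕ.+ t ∸ N)) + fromℕ ((n ℕ.+ t) ℕ./ N)
      ≡⟨ fromℕ-+ (t ℕ.* (n ℕ./ N) ℕ.+ (n % N ℕ.+ t ∸ N)) ((n ℕ.+ t) ℕ./ N) ⟨
    fromℕ (t ℕ.* (n ℕ./ N) ℕ.+ (n % N ℕ.+ t ∸ N) ℕ.+ (n ℕ.+ t) ℕ./ N)
      ≡⟨ cong fromℕ (sum-floor-step n t t<N) ⟩
    fromℕ (suc t ℕ.* (n ℕ./ N) ℕ.+ (n % N ℕ.+ suc t ∸ N))
      ∎
    where open ≡-Reasoning

module _ (m : ℕ) where
  private
    2m≡m+m : 2 ℕ.* m ≡ m ℕ.+ m
    2m≡m+m = cong (m ℕ.+_) (ℕ.+-identityʳ m)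

  2*[r+m∸2m]+r⊓[2m∸r]≡r : ∀ r → r ≤ 2 ℕ.* m → 2 ℕ.* (r ℕ.+ m ∸ 2 ℕ.* m) ℕ.+ r ℕ.⊓ (2 ℕ.* m ∸ r) ≡ r
  2*[r+m∸2m]+r⊓[2m∸r]≡r r r≤2m with ℕ.≤-total r m
  ... | inj₁ r≤m = cong₂ (λ e z → 2 ℕ.* e ℕ.+ z) no-excess (ℕ.m≤n⇒m⊓n≡m r≤2m∸r)
    where
    no-excess : r ℕ.+ m ∸ 2 ℕ.* m ≡ 0
    no-excess = ℕ.m≤n⇒m∸n≡0 (subst (r ℕ.+ m ≤_) (sym 2m≡m+m) (ℕ.+-monoˡ-≤ m r≤m))
    r≤2m∸r : r ≤ 2 ℕ.* m ∸ r
    r≤2m∸r = ℕ.m+n≤o⇒m≤o∸n r (subst (r ℕ.+ r ≤_) (sym 2m≡m+m) (ℕ.+-mono-≤ r≤m r≤m))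
  ... | inj₂ m≤r = begin
    2 ℕ.* (r ℕ.+ m ∸ 2 ℕ.* m) ℕ.+ r ℕ.⊓ (2 ℕ.* m ∸ r)  ≡⟨ cong₂ (λ e z → 2 ℕ.* e ℕ.+ z) excess (ℕ.m≥n⇒m⊓n≡n 2m∸r≤r) ⟩
    2 ℕ.* s ℕ.+ (2 ℕ.* m ∸ r)                          ≡⟨ cong (2 ℕ.* s ℕ.+_) deficit ⟩
    2 ℕ.* s ℕ.+ (m ∸ s)                                ≡⟨ cong (λ e → s ℕ.+ e ℕ.+ (m ∸ s)) (ℕ.+-identityʳ s) ⟩
    s ℕ.+ s ℕ.+ (m ∸ s)                                ≡⟨ ℕ.+-assoc s s (m ∸ s) ⟩
    s ℕ.+ (s ℕ.+ (m ∸ s))                              ≡⟨ cong (s ℕ.+_) (ℕ.m+[n∸m]≡n s≤m) ⟩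
    s ℕ.+ m                                            ≡⟨ ℕ.+-comm s m ⟩
    m ℕ.+ s                                            ≡⟨ r≡m+s ⟨
    r                                                  ∎
    where
    open ≡-Reasoning
    s = r ∸ m
    r≡m+s : r ≡ m ℕ.+ s
    r≡m+s = sym (ℕ.m+[n∸m]≡n m≤r)
    s≤m : s ≤ m
    s≤m = ℕ.+-cancelˡ-≤ m s m (subst₂ _≤_ r≡m+s 2m≡m+m r≤2m)
    excess : r ℕ.+ m ∸ 2 ℕ.* m ≡ s
    excess = trans (cong₂ _∸_ (ℕ.+-comm r m) 2m≡m+m) (ℕ.[m+n]∸[m+o]≡n∸o m r m)
    deficit : 2 ℕ.* m ∸ r ≡ m ∸ s
    deficit = trans (cong₂ _∸_ 2m≡m+m r≡m+s) (ℕ.[m+n]∸[m+o]≡n∸o m m s)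
    2m∸r≤r : 2 ℕ.* m ∸ r ≤ r
    2m∸r≤r = subst (_≤ r) (sym deficit) (ℕ.≤-trans (ℕ.m∸n≤m m s) m≤r)

sumBelow-cong : ∀ t {f g : ℕ → ℚ} → (∀ i → f i ≡ g i) → sumBelow t f ≡ sumBelow t g
sumBelow-cong zero    f≗g = refl
sumBelow-cong (suc t) f≗g = cong₂ _+_ (sumBelow-cong t f≗g) (f≗g t)

sumTo-cong : ∀ L {f g : ℕ → ℚ} → (∀ k → f k ≡ g k) → sumTo L f ≡ sumTo L g
sumTo-cong zero    f≗g = f≗g 0
sumTo-cong (suc L) f≗g = cong₂ _+_ (sumTo-cong L f≗g) (f≗g (suc L))

sumTo-const-sub : ∀ L h (g : ℕ → ℚ) → sumTo L (λ k → h - g k) ≡ h * fromℕ (suc L) - sumTo L g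
sumTo-const-sub zero    h g = solve 2 (λ h g → h :- g := h :* con ℚ.1ℚ :- g) refl h (g 0)
sumTo-const-sub (suc L) h g = begin
  sumTo L (λ k → h - g k) + (h - g (suc L))
    ≡⟨ cong (_+ (h - g (suc L))) (sumTo-const-sub L h g) ⟩
  (h * fromℕ (suc L) - sumTo L g) + (h - g (suc L))
    ≡⟨ solve 4 (λ h l s x → (h :* l :- s) :+ (h :- x) := h :* (con ℚ.1ℚ :+ l) :- (s :+ x))
               refl h (fromℕ (suc L)) (sumTo L g) (g (suc L)) ⟩
  h * (ℚ.1ℚ + fromℕ (suc L)) - (sumTo L g + g (suc L))
    ≡⟨ cong (λ l → h * l - sumTo (suc L) g) (fromℕ-+ 1 (suc L)) ⟨
  h * fromℕ (suc (suc L)) - sumTo (suc L) g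
    ∎
  where open ≡-Reasoning

module _ (m : ℕ) .{{_ : NonZero m}} where
  private
    instance
      2m≢0 : NonZero (2 ℕ.* m)
      2m≢0 = ℕ.m*n≢0 2 m

  sum-floor≡half-sub-Zigzag : ∀ n →
    sumBelow m (λ i → fromℤ (floor (+ (n ℕ.+ i) / (2 ℕ.* m))))
      ≡ (+ n / 2) - fromℕ m * Zigzag (+ n / (2 ℕ.* m))
  sum-floor≡half-sub-Zigzag n = begin
    sumBelow m (λ i → fromℤ (floor (+ (n ℕ.+ i) / N)))
      ≡⟨ sumBelow-cong m (λ i → cong fromℤ (floor-/ (n ℕ.+ i) N)) ⟩
    sumBelow m (λ i → fromℕ ((n ℕ.+ i) ℕ./ N))
      ≡⟨ sum-floor N n m (ℕ.m≤m+n m (m ℕ.+ 0)) ⟩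
    fromℕ c
      ≡⟨ halve (fromℕ c) (+ n / 2) (fromℕ m) Z (fromℕ z) (fromℕ n) 2c+z≡n (fromℕ-*-/ 2 (+ n)) 2mZ≡z ⟩
    (+ n / 2) - fromℕ m * Z
      ∎
    where
    open ≡-Reasoning
    N = 2 ℕ.* m
    q = n ℕ./ N
    r = n % N
    c = m ℕ.* q ℕ.+ (r ℕ.+ m ∸ N)
    z = r ℕ.⊓ (N ∸ r)
    Z = Zigzag (+ n / N)

    regroup : ∀ m q e z → 2 ℕ.* (m ℕ.* q ℕ.+ e) ℕ.+ z ≡ q ℕ.* (2 ℕ.* m) ℕ.+ (2 ℕ.* e ℕ.+ z)
    regroup = ℕ-Solver.solve-∀

    2c+z≡n : fromℕ 2 * fromℕ c + fromℕ z ≡ fromℕ n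
    2c+z≡n = begin
      fromℕ 2 * fromℕ c + fromℕ z  ≡⟨ cong (_+ fromℕ z) (fromℕ-* 2 c) ⟨
      fromℕ (2 ℕ.* c) + fromℕ z    ≡⟨ fromℕ-+ (2 ℕ.* c) z ⟨
      fromℕ (2 ℕ.* c ℕ.+ z)        ≡⟨ cong fromℕ (regroup m q (r ℕ.+ m ∸ N) z) ⟩
      fromℕ (q ℕ.* N ℕ.+ (2 ℕ.* (r ℕ.+ m ∸ N) ℕ.+ z))
        ≡⟨ cong (λ e → fromℕ (q ℕ.* N ℕ.+ e)) (2*[r+m∸2m]+r⊓[2m∸r]≡r m r (ℕ.<⇒≤ (m%n<n n N))) ⟩
      fromℕ (q ℕ.* N ℕ.+ r)        ≡⟨ cong fromℕ (trans (ℕ.+-comm (q ℕ.* N) r) (sym (m≡m%n+[m/n]*n n N))) ⟩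
      fromℕ n                      ∎

    2mZ≡z : (fromℕ 2 * fromℕ m) * Z ≡ fromℕ z
    2mZ≡z = trans (cong (_* Z) (sym (fromℕ-* 2 m))) (*-Zigzag-/ n N)

-- Each level identity holds for every n.
theorem2p5 : (n : ℕ) → 0 < n →
    sumTo ⌊log₂ n ⌋ (λ k → sumBelow (2 ^ k) (λ i → fromℤ (floor ((n Data.Nat.+ i) /2^ suc k))))
      ≡ ((+ n) / 2) * fromℕ (suc ⌊log₂ n ⌋)
        - sumTo ⌊log₂ n ⌋ (λ k → fromℕ (2 ^ k) * Zigzag (n /2^ suc k))
theorem2p5 n _ = begin
  sumTo ⌊log₂ n ⌋ (λ k → sumBelow (2 ^ k) (λ i → fromℤ (floor ((n ℕ.+ i) /2^ suc k))))
    ≡⟨ sumTo-cong ⌊log₂ n ⌋ (λ k → sum-floor≡half-sub-Zigzag (2 ^ k) {{ℕ.m^n≢0 2 k}} n) ⟩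
  sumTo ⌊log₂ n ⌋ (λ k → (+ n / 2) - fromℕ (2 ^ k) * Zigzag (n /2^ suc k))
    ≡⟨ sumTo-const-sub ⌊log₂ n ⌋ (+ n / 2) (λ k → fromℕ (2 ^ k) * Zigzag (n /2^ suc k)) ⟩
  (+ n / 2) * fromℕ (suc ⌊log₂ n ⌋) - sumTo ⌊log₂ n ⌋ (λ k → fromℕ (2 ^ k) * Zigzag (n /2^ suc k))
    ∎
  where open ≡-Reasoning
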